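{- Let $1 \leq k < r$ be integers and let $H$ be an $r$-uniform hypergraph. Then $$\gamma(H) - k + 1 \leq \iota(H, K_k^r) \leq \gamma(H).$$ Moreover, for every integer $q \geq 1$, there exist two connected $r$-uniform hypergraphs $H$ and $I$ such that $\iota(H, K_k^r) = \gamma(H) = q = \iota(I, K_k^r) = \gamma(I) - k + 1$.
   Context: A hypergraph $H$ is a pair $(V(H), E(H))$ with $E(H)$ a family of subsets of the finite set $V(H)$; it is $r$-uniform if every edge has exactly $r$ elements. $w \neq v$ is a neighbour of $v$ if $v,w \in e$ for some edge $e$; $N_H[v]$ is $v$ together with its neighbours, and $N_H[D] = \bigcup_{v \in D} N_H[v]$. $H$ is connected if for all distinct $v,w \in V(H)$ there are edges $e_1,\dots,e_t$ with $v \in e_1$, $w \in e_t$, $e_i \cap e_{i+1} \neq \emptyset$. $K_k^r$ is the $r$-graph with vertex set $[k]=\{1,\dots,k\}$ and edge set the family of $r$-subsets of $[k]$ (so for $k<r$ it has no edges). A copy of $F$ is a hypergraph obtained by bijectively relabelling the vertices of $F$; $H$ contains $F'$ if $V(F') \subseteq V(H)$ and $E(F')\subseteq E(H)$. $D \subseteq V(H)$ is a $K_k^r$-isolating set of $H$ if $N_H[D]$ meets the vertex set of every copy of $K_k^r$ contained by $H$; $\iota(H,K_k^r)$ is the minimum size of such a set. $D$ is a dominating set if $N_H[D] = V(H)$, and $\gamma(H)$ is the minimum size of a dominating set. -}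

module Defs where

open import Data.Nat using (ℕ; _≤_; _<_; _+_)
open import Data.Fin using (Fin)
open import Data.Fin.Subset using (Subset; _∈_; ∣_∣)
open import Data.Product using (Σ; ∃; ∃-syntax; _×_)
open import Data.Sum using (_⊎_)
open import Function.Definitions using (Injective)
open import Relation.Binary.PropositionalEquality using (_≡_; _≢_)
open import Function.Bundles using (_⇔_)

record Hypergraph : Set₁ where
  field
    n    : ℕ
    Edge : Subset n → Set
open Hypergraph public

V : Hypergraph → Set
V H = Fin (n H)

Uniform : ℕ → Hypergraph → Set
Uniform r H = ∀ (e : Subset (n H)) → Edge H e → ∣ e ∣ ≡ r

Neighbour : (H : Hypergraph) → V H → V H → Set
Neighbour H v w = w ≢ v × ∃[ e ] (Edge H e × v ∈ e × w ∈ e)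

InClosedNbhd : (H : Hypergraph) → V H → V H → Set
InClosedNbhd H v u = u ≡ v ⊎ Neighbour H v u

InClosedNbhdSet : (H : Hypergraph) → Subset (n H) → V H → Set
InClosedNbhdSet H D u = ∃[ v ] (v ∈ D × InClosedNbhd H v u)

K : ℕ → ℕ → Hypergraph
K k r = record { n = k ; Edge = λ S → ∣ S ∣ ≡ r }

IsImage : ∀ {a b} → (Fin a → Fin b) → Subset a → Subset b → Set
IsImage f e e' = ∀ u → (u ∈ e') ⇔ (∃[ i ] (i ∈ e × f i ≡ u))

CopyIn : (F H : Hypergraph) → (V F → V H) → Set
CopyIn F H f = Injective _≡_ _≡_ f
  × (∀ e → Edge F e → ∃[ e' ] (Edge H e' × IsImage f e e'))

Isolating : (H F : Hypergraph) → Subset (n H) → Set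
Isolating H F D = ∀ f → CopyIn F H f → ∃[ i ] InClosedNbhdSet H D (f i)

Dominating : (H : Hypergraph) → Subset (n H) → Set
Dominating H D = ∀ u → InClosedNbhdSet H D u

IsMinSize : ∀ {N} → (Subset N → Set) → ℕ → Set
IsMinSize P m = (∃[ D ] (P D × ∣ D ∣ ≡ m)) × (∀ D → P D → m ≤ ∣ D ∣)

IsIota : Hypergraph → Hypergraph → ℕ → Set
IsIota H F m = IsMinSize (Isolating H F) m

IsGamma : Hypergraph → ℕ → Set
IsGamma H m = IsMinSize (Dominating H) m

data EdgeChain (H : Hypergraph) (w : V H) : Subset (n H) → Set where
  end  : ∀ {e} → Edge H e → w ∈ e → EdgeChain H w e
  step : ∀ {e e'} → Edge H e → (∃[ u ] (u ∈ e × u ∈ e')) → EdgeChain H w e' → EdgeChain H w e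

Connected : Hypergraph → Set
Connected H = ∀ (v w : V H) → v ≢ w → ∃[ e ] (v ∈ e × EdgeChain H w e)

{-# OPTIONS --safe #-}
-- Since k < r, K_k^r has no edges, so a copy of it in H is just a set of k vertices. Hence D is
-- K_k^r-isolating exactly when fewer than k vertices lie outside N[D], and adding them to D gives a
-- dominating set: γ ≤ ι + k − 1. Membership in N[D] need not be decidable, but the inequality is, so
-- it may be proved under a double negation. A dominating set isolates every nonempty F, so ι ≤ γ.
--
-- For sharpness take q ≥ 1 core blocks, p pendant blocks of r vertices each and r − 1 extra vertices;
-- every block is an edge, spoke j joins the centre of core block j to the extra vertices, and link t
-- joins the centre of core block 0 to the non-centre vertices of pendant block t. The non-centre
-- vertices of core blocks and the centres of pendant blocks lie in no other edge, so a dominating set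
-- meets every block, and a K_k^r-isolating set meets every core block (a copy of K_k^r fits on the
-- non-centre vertices of a core block). The core centres dominate all but the p pendant centres, so
-- they isolate K_{p+1}^r. Taking p = 0 and p = k − 1 gives the two hypergraphs.
module Submission where

open import Defs
open import Data.Nat using (ℕ; zero; suc; _≤_; _<_; _+_; _*_; _∸_; z≤n; s≤s; _≤?_)
open import Data.Nat.Properties
  using (≤-antisym; ≰⇒>; <⇒≱; m≤n⇒m≤1+n; n<1+n; +-suc; +-comm; +-identityʳ; +-assoc; +-monoˡ-≤; +-monoʳ-≤;
         module ≤-Reasoning)
open import Data.Fin using (Fin; zero; suc; inject≤; _≟_)
open import Data.Fin.Properties
  using (injective⇒≤; suc-injective; inject≤-injective; pigeonhole; <⇒≢; +↔⊎; *↔×)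
open import Data.Fin.Subset using (Subset; _∈_; ∣_∣; ⁅_⁆; _∪_; inside; outside) renaming (⊥ to ∅)
open import Data.Fin.Subset.Properties using (x∈p∪q⁻; x∈p∪q⁺; ∉⊥; x∈⁅x⁆; x∈⁅y⁆⇒x≡y; ∣p∣≤n)
open import Data.Vec using ([]; _∷_; here; there)
open import Data.Product using (∃; ∃-syntax; _×_; _,_; proj₁; proj₂)
open import Data.Product.Properties using (,-injectiveˡ; ,-injectiveʳ)
open import Data.Product.Function.NonDependent.Propositional using (_×-↔_)
open import Data.Sum using (_⊎_; inj₁; inj₂)
open import Data.Sum.Properties using (inj₁-injective; inj₂-injective)
open import Data.Sum.Function.Propositional using (_⊎-↔_)
open import Data.Empty using (⊥-elim)
open import Function using (_∘_; id; _↔_; Inverse; Injection)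
open import Function.Definitions using (Injective)
open import Function.Properties.Inverse using (↔-refl; ↔-sym; ↔-trans; ↔⇒↣)
open import Relation.Nullary using (¬_; yes; no; does)
open import Relation.Nullary.Decidable using (decidable-stable; ¬¬-excluded-middle; ¬?)
open import Relation.Unary using (Decidable)
open import Relation.Binary.PropositionalEquality
  using (_≡_; refl; sym; trans; cong; subst; subst₂; module ≡-Reasoning)

enumerate : ∀ {n} (p : Subset n) → Fin ∣ p ∣ → Fin n
enumerate (inside ∷ p) zero = zero
enumerate (inside ∷ p) (suc i) = suc (enumerate p i)
enumerate (outside ∷ p) i = suc (enumerate p i)

enumerate-∈ : ∀ {n} (p : Subset n) i → enumerate p i ∈ p
enumerate-∈ (inside ∷ p) zero = here
enumerate-∈ (inside ∷ p) (suc i) = there (enumerate-∈ p i)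
enumerate-∈ (outside ∷ p) i = there (enumerate-∈ p i)

enumerate-injective : ∀ {n} (p : Subset n) → Injective _≡_ _≡_ (enumerate p)
enumerate-injective (inside ∷ p) {zero} {zero} _ = refl
enumerate-injective (inside ∷ p) {zero} {suc _} ()
enumerate-injective (inside ∷ p) {suc _} {zero} ()
enumerate-injective (inside ∷ p) {suc _} {suc _} eq = cong suc (enumerate-injective p (suc-injective eq))
enumerate-injective (outside ∷ p) eq = enumerate-injective p (suc-injective eq)

enumerate-surjective : ∀ {n} (p : Subset n) {x} → x ∈ p → ∃[ i ] enumerate p i ≡ x
enumerate-surjective (inside ∷ p) here = zero , refl
enumerate-surjective (inside ∷ p) (there x∈p) =
  let i , eq = enumerate-surjective p x∈p in suc i , cong suc eq
enumerate-surjective (outside ∷ p) (there x∈p) =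
  let i , eq = enumerate-surjective p x∈p in i , cong suc eq

injective⇒m≤∣p∣ : ∀ {m n} {p : Subset n} (f : Fin m → Fin n) →
                  Injective _≡_ _≡_ f → (∀ i → f i ∈ p) → m ≤ ∣ p ∣
injective⇒m≤∣p∣ {p = p} f f-injective f∈p = injective⇒≤ position-injective
  where
  position : ∀ i → ∃[ j ] enumerate p j ≡ f i
  position i = enumerate-surjective p (f∈p i)
  position-injective : Injective _≡_ _≡_ (proj₁ ∘ position)
  position-injective {i} {j} eq =
    f-injective (trans (sym (proj₂ (position i))) (trans (cong (enumerate p) eq) (proj₂ (position j))))

m≤∣p∣⇒injective : ∀ {m n} {p : Subset n} → m ≤ ∣ p ∣ →
                  ∃[ f ] (Injective _≡_ _≡_ f × ∀ (i : Fin m) → f i ∈ p)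
m≤∣p∣⇒injective {p = p} m≤∣p∣ =
  (λ i → enumerate p (inject≤ i m≤∣p∣)) ,
  (λ eq → inject≤-injective m≤∣p∣ m≤∣p∣ _ _ (enumerate-injective p eq)) ,
  (λ i → enumerate-∈ p (inject≤ i m≤∣p∣))

∣p∪q∣≤∣p∣+∣q∣ : ∀ {n} (p q : Subset n) → ∣ p ∪ q ∣ ≤ ∣ p ∣ + ∣ q ∣
∣p∪q∣≤∣p∣+∣q∣ [] [] = z≤n
∣p∪q∣≤∣p∣+∣q∣ (inside ∷ p) (inside ∷ q) rewrite +-suc ∣ p ∣ ∣ q ∣ =
  s≤s (m≤n⇒m≤1+n (∣p∪q∣≤∣p∣+∣q∣ p q))
∣p∪q∣≤∣p∣+∣q∣ (inside ∷ p) (outside ∷ q) = s≤s (∣p∪q∣≤∣p∣+∣q∣ p q)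
∣p∪q∣≤∣p∣+∣q∣ (outside ∷ p) (inside ∷ q) rewrite +-suc ∣ p ∣ ∣ q ∣ =
  s≤s (∣p∪q∣≤∣p∣+∣q∣ p q)
∣p∪q∣≤∣p∣+∣q∣ (outside ∷ p) (outside ∷ q) = ∣p∪q∣≤∣p∣+∣q∣ p q

image : ∀ {m n} → (Fin m → Fin n) → Subset n
image {zero} f = ∅
image {suc m} f = ⁅ f zero ⁆ ∪ image (f ∘ suc)

∈-image⁺ : ∀ {m n} (f : Fin m → Fin n) i → f i ∈ image f
∈-image⁺ f zero = x∈p∪q⁺ {p = ⁅ f zero ⁆} {q = image (f ∘ suc)} (inj₁ (x∈⁅x⁆ (f zero)))
∈-image⁺ f (suc i) = x∈p∪q⁺ {p = ⁅ f zero ⁆} {q = image (f ∘ suc)} (inj₂ (∈-image⁺ (f ∘ suc) i))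

∈-image⁻ : ∀ {m n} (f : Fin m → Fin n) {u} → u ∈ image f → ∃[ i ] f i ≡ u
∈-image⁻ {zero} f u∈∅ = ⊥-elim (∉⊥ u∈∅)
∈-image⁻ {suc m} f u∈ with x∈p∪q⁻ ⁅ f zero ⁆ (image (f ∘ suc)) u∈
... | inj₁ u∈⁅f0⁆ = zero , sym (x∈⁅y⁆⇒x≡y _ u∈⁅f0⁆)
... | inj₂ u∈rest = let i , eq = ∈-image⁻ (f ∘ suc) u∈rest in suc i , eq

injective⇒∣image∣≡m : ∀ {m n} (f : Fin m → Fin n) → Injective _≡_ _≡_ f → ∣ image f ∣ ≡ m
injective⇒∣image∣≡m f f-injective =
  ≤-antisym (injective⇒≤ preimage-injective) (injective⇒m≤∣p∣ f f-injective (∈-image⁺ f))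
  where
  preimage : ∀ j → ∃[ i ] f i ≡ enumerate (image f) j
  preimage j = ∈-image⁻ f (enumerate-∈ (image f) j)
  preimage-injective : Injective _≡_ _≡_ (proj₁ ∘ preimage)
  preimage-injective {j} {j′} eq = enumerate-injective (image f)
    (trans (sym (proj₂ (preimage j))) (trans (cong f eq) (proj₂ (preimage j′))))

fromDecidable : ∀ {n} {P : Fin n → Set} → Decidable P → Subset n
fromDecidable {zero} P? = []
fromDecidable {suc n} P? = does (P? zero) ∷ fromDecidable (P? ∘ suc)

∈-fromDecidable⁺ : ∀ {n} {P : Fin n → Set} (P? : Decidable P) {u} → P u → u ∈ fromDecidable P?
∈-fromDecidable⁺ P? {zero} Pu with P? zero
... | yes _ = here
... | no ¬Pu = ⊥-elim (¬Pu Pu)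
∈-fromDecidable⁺ P? {suc u} Pu = there (∈-fromDecidable⁺ (P? ∘ suc) Pu)

∈-fromDecidable⁻ : ∀ {n} {P : Fin n → Set} (P? : Decidable P) {u} → u ∈ fromDecidable P? → P u
∈-fromDecidable⁻ P? {zero} u∈ with P? zero
∈-fromDecidable⁻ P? {zero} here | yes Pu = Pu
∈-fromDecidable⁻ P? {suc u} (there u∈) = ∈-fromDecidable⁻ (P? ∘ suc) u∈

¬¬-decidable : ∀ {n} (P : Fin n → Set) → ¬ ¬ Decidable P
¬¬-decidable {zero} P ¬P? = ¬P? λ ()
¬¬-decidable {suc n} P ¬P? = ¬¬-excluded-middle λ P0? → ¬¬-decidable (P ∘ suc) λ P+? →
  ¬P? λ { zero → P0? ; (suc u) → P+? u }

all-or-any : ∀ {m} {A B : Fin m → Set} → (∀ i → A i ⊎ B i) → (∀ i → A i) ⊎ ∃ B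
all-or-any {zero} A⊎B = inj₁ λ ()
all-or-any {suc m} A⊎B with A⊎B zero | all-or-any (A⊎B ∘ suc)
... | inj₂ b | _ = inj₂ (zero , b)
... | inj₁ _ | inj₂ (i , b) = inj₂ (suc i , b)
... | inj₁ a | inj₁ as = inj₁ λ { zero → a ; (suc i) → as i }

K-copy : ∀ {k r} (H : Hypergraph) → k < r → {f : Fin k → V H} →
         Injective _≡_ _≡_ f → CopyIn (K k r) H f
K-copy H k<r f-injective = f-injective , λ e ∣e∣≡r → ⊥-elim (<⇒≱ k<r (subst (_≤ _) ∣e∣≡r (∣p∣≤n e)))

dominating⇒isolating : ∀ {H} F {D} → V F → Dominating H D → Isolating H F D
dominating⇒isolating F x D-dominating f _ = x , D-dominating (f x)

module Undominated (H : Hypergraph) {D : Subset (n H)} (N[D]? : Decidable (InClosedNbhdSet H D)) where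

  undominated : Subset (n H)
  undominated = fromDecidable (¬? ∘ N[D]?)

  ∪-undominated-dominating : Dominating H (D ∪ undominated)
  ∪-undominated-dominating u with N[D]? u
  ... | yes (v , v∈D , u∈N[v]) = v , x∈p∪q⁺ {p = D} {q = undominated} (inj₁ v∈D) , u∈N[v]
  ... | no u∉N[D] =
    u , x∈p∪q⁺ {p = D} {q = undominated} (inj₂ (∈-fromDecidable⁺ (¬? ∘ N[D]?) u∉N[D])) , inj₁ refl

  ∣undominated∣<k : ∀ {k r} → k < r → Isolating H (K k r) D → ∣ undominated ∣ < k
  ∣undominated∣<k k<r D-isolating = ≰⇒> λ k≤∣U∣ →
    let f , f-injective , f∈U = m≤∣p∣⇒injective k≤∣U∣
        i , fi∈N[D] = D-isolating f (K-copy H k<r f-injective)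
    in ∈-fromDecidable⁻ (¬? ∘ N[D]?) (f∈U i) fi∈N[D]

γ+1≤ι+k : ∀ {k r g} (H : Hypergraph) {D} → k < r → Isolating H (K k r) D →
          (∀ D′ → Dominating H D′ → g ≤ ∣ D′ ∣) → g + 1 ≤ ∣ D ∣ + k
γ+1≤ι+k {k} {g = g} H {D} k<r D-isolating γ-minimal =
  decidable-stable (g + 1 ≤? ∣ D ∣ + k) λ ¬bound → ¬¬-decidable (InClosedNbhdSet H D) (¬bound ∘ bound)
  where
  bound : Decidable (InClosedNbhdSet H D) → g + 1 ≤ ∣ D ∣ + k
  bound N[D]? = begin
    g + 1                    ≤⟨ +-monoˡ-≤ 1 (γ-minimal (D ∪ U) ∪-undominated-dominating) ⟩
    ∣ D ∪ U ∣ + 1            ≤⟨ +-monoˡ-≤ 1 (∣p∪q∣≤∣p∣+∣q∣ D U) ⟩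
    ∣ D ∣ + ∣ U ∣ + 1        ≡⟨ +-assoc ∣ D ∣ ∣ U ∣ 1 ⟩
    ∣ D ∣ + (∣ U ∣ + 1)      ≡⟨ cong (∣ D ∣ +_) (+-comm ∣ U ∣ 1) ⟩
    ∣ D ∣ + suc ∣ U ∣        ≤⟨ +-monoʳ-≤ ∣ D ∣ (∣undominated∣<k k<r D-isolating) ⟩
    ∣ D ∣ + k                ∎
    where
    open Undominated H N[D]? renaming (undominated to U)
    open ≤-Reasoning

ι-γ-bounds : ∀ {k r} → suc k < r → (H : Hypergraph) → ∀ {i g} →
             IsIota H (K (suc k) r) i → IsGamma H g → (g + 1 ≤ i + suc k) × (i ≤ g)
ι-γ-bounds {k} {r} k<r H ((D , D-isolating , refl) , ι-minimal) ((D′ , D′-dominating , refl) , γ-minimal) =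
  γ+1≤ι+k H k<r D-isolating γ-minimal , ι-minimal D′ (dominating⇒isolating (K (suc k) r) zero D′-dominating)

module EdgeFamily {X L : Set} {N r : ℕ} (index : X ↔ Fin N)
                  (edge : L → Fin r → X) (edge-injective : ∀ ℓ → Injective _≡_ _≡_ (edge ℓ)) where

  ⌜_⌝ : X → Fin N
  ⌜_⌝ = Inverse.to index

  ⌜⌝-injective : Injective _≡_ _≡_ ⌜_⌝
  ⌜⌝-injective = Injection.injective (↔⇒↣ index)

  ⌜⌝∘-injective : ∀ {A : Set} {f : A → X} → Injective _≡_ _≡_ f → Injective _≡_ _≡_ (⌜_⌝ ∘ f)
  ⌜⌝∘-injective f-injective = f-injective ∘ ⌜⌝-injective

  vertex-elim : (P : Fin N → Set) → (∀ x → P ⌜ x ⌝) → ∀ u → P u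
  vertex-elim P P⌜⌝ u = subst P (Inverse.strictlyInverseˡ index u) (P⌜⌝ (Inverse.from index u))

  ⟦_⟧ : L → Subset N
  ⟦ ℓ ⟧ = image (⌜_⌝ ∘ edge ℓ)

  hypergraph : Hypergraph
  hypergraph = record { n = N ; Edge = λ e → ∃[ ℓ ] e ≡ ⟦ ℓ ⟧ }

  uniform : Uniform r hypergraph
  uniform _ (ℓ , refl) = injective⇒∣image∣≡m (⌜_⌝ ∘ edge ℓ) (⌜⌝∘-injective (edge-injective ℓ))

  ∈⟦⟧ : ∀ ℓ i → ⌜ edge ℓ i ⌝ ∈ ⟦ ℓ ⟧
  ∈⟦⟧ ℓ = ∈-image⁺ (⌜_⌝ ∘ edge ℓ)

  same-edge⇒closedNbhd : ∀ ℓ i j → InClosedNbhd hypergraph ⌜ edge ℓ i ⌝ ⌜ edge ℓ j ⌝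
  same-edge⇒closedNbhd ℓ i j with ⌜ edge ℓ j ⌝ ≟ ⌜ edge ℓ i ⌝
  ... | yes eq = inj₁ eq
  ... | no neq = inj₂ (neq , ⟦ ℓ ⟧ , (ℓ , refl) , ∈⟦⟧ ℓ i , ∈⟦⟧ ℓ j)

  closedNbhd-within : (P : X → Set) {x : X} → P x → (∀ {ℓ i} → edge ℓ i ≡ x → ∀ j → P (edge ℓ j)) →
                      ∀ {v} → InClosedNbhd hypergraph v ⌜ x ⌝ → ∃[ y ] (P y × v ≡ ⌜ y ⌝)
  closedNbhd-within P {x} Px edges-through-x (inj₁ x≡v) = x , Px , sym x≡v
  closedNbhd-within P Px edges-through-x (inj₂ (_ , _ , (ℓ , refl) , v∈ℓ , x∈ℓ)) =
    let i , ℓi≡x = ∈-image⁻ (⌜_⌝ ∘ edge ℓ) x∈ℓ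
        j , ℓj≡v = ∈-image⁻ (⌜_⌝ ∘ edge ℓ) v∈ℓ
    in edge ℓ j , edges-through-x (⌜⌝-injective ℓi≡x) j , sym ℓj≡v

  chain-end : ∀ ℓ i → EdgeChain hypergraph ⌜ edge ℓ i ⌝ ⟦ ℓ ⟧
  chain-end ℓ i = end (ℓ , refl) (∈⟦⟧ ℓ i)

  chain-step : ∀ {w} ℓ ℓ′ i i′ → edge ℓ i ≡ edge ℓ′ i′ →
               EdgeChain hypergraph w ⟦ ℓ′ ⟧ → EdgeChain hypergraph w ⟦ ℓ ⟧
  chain-step ℓ ℓ′ i i′ shared =
    step (ℓ , refl) (⌜ edge ℓ i ⌝ , ∈⟦⟧ ℓ i , subst (_∈ ⟦ ℓ′ ⟧) (cong ⌜_⌝ (sym shared)) (∈⟦⟧ ℓ′ i′))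

  connected-via : (hub : L) → (∀ x → EdgeChain hypergraph ⌜ x ⌝ ⟦ hub ⟧) →
                  (∀ x → ∃[ ℓ ] (⌜ x ⌝ ∈ ⟦ ℓ ⟧ ×
                     ∀ {w} → EdgeChain hypergraph w ⟦ hub ⟧ → EdgeChain hypergraph w ⟦ ℓ ⟧)) →
                  Connected hypergraph
  connected-via hub hub⇝ ⇝hub v w _ =
    vertex-elim (λ v → ∃[ e ] (v ∈ e × EdgeChain hypergraph w e)) via-hub v
    where
    via-hub : ∀ x → ∃[ e ] (⌜ x ⌝ ∈ e × EdgeChain hypergraph w e)
    via-hub x =
      let ℓ , x∈ℓ , ℓ⇝ = ⇝hub x
      in ⟦ ℓ ⟧ , x∈ℓ , ℓ⇝ (vertex-elim (λ w → EdgeChain hypergraph w ⟦ hub ⟧) hub⇝ w)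

module Construction (q p s : ℕ) where

  r : ℕ
  r = suc (suc s)

  Block : Set
  Block = Fin (suc q) ⊎ Fin p

  pattern core j = inj₁ j
  pattern pendant t = inj₂ t

  Vertex : Set
  Vertex = (Block × Fin r) ⊎ Fin (suc s)

  pattern ⟨_,_⟩ b a = inj₁ (b , a)
  pattern extra z = inj₂ z

  index : Vertex ↔ Fin ((suc q + p) * r + suc s)
  index = ↔-sym (↔-trans +↔⊎ (↔-trans *↔× (+↔⊎ ×-↔ ↔-refl) ⊎-↔ ↔-refl))

  data Label : Set where
    block : Block → Label
    spoke : Fin (suc q) → Label
    link  : Fin p → Label

  edge : Label → Fin r → Vertex
  edge (block b) a = ⟨ b , a ⟩
  edge (spoke j) zero = ⟨ core j , zero ⟩
  edge (spoke j) (suc z) = extra z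
  edge (link t) zero = ⟨ core zero , zero ⟩
  edge (link t) (suc a) = ⟨ pendant t , suc a ⟩

  edge-injective : ∀ ℓ → Injective _≡_ _≡_ (edge ℓ)
  edge-injective (block b) refl = refl
  edge-injective (spoke j) {zero} {zero} _ = refl
  edge-injective (spoke j) {zero} {suc _} ()
  edge-injective (spoke j) {suc _} {zero} ()
  edge-injective (spoke j) {suc _} {suc _} refl = refl
  edge-injective (link t) {zero} {zero} _ = refl
  edge-injective (link t) {zero} {suc _} ()
  edge-injective (link t) {suc _} {zero} ()
  edge-injective (link t) {suc _} {suc _} refl = refl

  open EdgeFamily index edge edge-injective public renaming (hypergraph to G)

  data Private : Block → Fin r → Set where
    core-rim       : ∀ j a → Private (core j) (suc a)
    pendant-centre : ∀ t → Private (pendant t) zero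

  private-vertex : ∀ b → ∃ (Private b)
  private-vertex (core j) = suc zero , core-rim j zero
  private-vertex (pendant t) = zero , pendant-centre t

  InBlock : Block → Vertex → Set
  InBlock b x = ∃[ a ] x ≡ ⟨ b , a ⟩

  private-edge : ∀ {b a} → Private b a → ∀ {ℓ i} → edge ℓ i ≡ ⟨ b , a ⟩ →
                 ∀ j → InBlock b (edge ℓ j)
  private-edge _ {block b} refl j = j , refl
  private-edge () {spoke j} {zero} refl
  private-edge _ {spoke j} {suc z} ()
  private-edge () {link t} {zero} refl
  private-edge () {link t} {suc a} refl

  Meets : Subset (n G) → Block → Set
  Meets D b = ∃[ a ] ⌜ ⟨ b , a ⟩ ⌝ ∈ D

  private-dominated⇒meets : ∀ {D b a} → Private b a → InClosedNbhdSet G D ⌜ ⟨ b , a ⟩ ⌝ → Meets D b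
  private-dominated⇒meets {b = b} b-private (v , v∈D , near) with
    closedNbhd-within (InBlock b) (_ , refl) (private-edge b-private) near
  ... | _ , (a′ , refl) , refl = a′ , v∈D

  meets⇒≤ : ∀ {m D} {β : Fin m → Block} → Injective _≡_ _≡_ β →
            (∀ c → Meets D (β c)) → m ≤ ∣ D ∣
  meets⇒≤ {β = β} β-injective meets =
    injective⇒m≤∣p∣ (⌜_⌝ ∘ witness) (⌜⌝∘-injective (β-injective ∘ ,-injectiveˡ ∘ inj₁-injective))
                    (proj₂ ∘ meets)
    where
    witness : Fin _ → Vertex
    witness c = ⟨ β c , proj₁ (meets c) ⟩

  dominating⇒≥ : ∀ {D} → Dominating G D → suc q + p ≤ ∣ D ∣
  dominating⇒≥ D-dominating = meets⇒≤ (Injection.injective (↔⇒↣ +↔⊎)) λ c →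
    private-dominated⇒meets (proj₂ (private-vertex (Inverse.to +↔⊎ c))) (D-dominating _)

  isolating⇒≥ : ∀ {k D} → k ≤ suc s → Isolating G (K k r) D → suc q ≤ ∣ D ∣
  isolating⇒≥ {k} {D} k≤ D-isolating = meets⇒≤ inj₁-injective meets-core
    where
    meets-core : ∀ j → Meets D (core j)
    meets-core j =
      let i , rim-i-dominated = D-isolating (⌜_⌝ ∘ rim) (K-copy G (s≤s k≤) (⌜⌝∘-injective rim-injective))
      in private-dominated⇒meets (core-rim j _) rim-i-dominated
      where
      rim : Fin k → Vertex
      rim i = ⟨ core j , suc (inject≤ i k≤) ⟩
      rim-injective : Injective _≡_ _≡_ rim
      rim-injective eq = inject≤-injective k≤ k≤ _ _ (suc-injective (,-injectiveʳ (inj₁-injective eq)))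

  centre : Block → Vertex
  centre b = ⟨ b , zero ⟩

  centre-injective : Injective _≡_ _≡_ centre
  centre-injective = ,-injectiveˡ ∘ inj₁-injective

  coreCentre : Fin (suc q) → Fin (n G)
  coreCentre = ⌜_⌝ ∘ centre ∘ core

  pendantCentre : Fin p → Fin (n G)
  pendantCentre = ⌜_⌝ ∘ centre ∘ pendant

  coreCentres pendantCentres : Subset (n G)
  coreCentres = image coreCentre
  pendantCentres = image pendantCentre

  ∣coreCentres∣ : ∣ coreCentres ∣ ≡ suc q
  ∣coreCentres∣ = injective⇒∣image∣≡m coreCentre (⌜⌝∘-injective (inj₁-injective ∘ centre-injective))

  ∣pendantCentres∣ : ∣ pendantCentres ∣ ≡ p
  ∣pendantCentres∣ = injective⇒∣image∣≡m pendantCentre (⌜⌝∘-injective (inj₂-injective ∘ centre-injective))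

  IsPendantCentre : Fin (n G) → Set
  IsPendantCentre u = ∃[ t ] u ≡ pendantCentre t

  pendantCentre-or-dominated : ∀ u → IsPendantCentre u ⊎ InClosedNbhdSet G coreCentres u
  pendantCentre-or-dominated = vertex-elim (λ u → IsPendantCentre u ⊎ InClosedNbhdSet G coreCentres u) cases
    where
    cases : ∀ x → IsPendantCentre ⌜ x ⌝ ⊎ InClosedNbhdSet G coreCentres ⌜ x ⌝
    cases ⟨ core j , a ⟩ =
      inj₂ (coreCentre j , ∈-image⁺ coreCentre j , same-edge⇒closedNbhd (block (core j)) zero a)
    cases ⟨ pendant t , zero ⟩ = inj₁ (t , refl)
    cases ⟨ pendant t , suc a ⟩ =
      inj₂ (coreCentre zero , ∈-image⁺ coreCentre zero , same-edge⇒closedNbhd (link t) zero (suc a))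
    cases (extra z) =
      inj₂ (coreCentre zero , ∈-image⁺ coreCentre zero , same-edge⇒closedNbhd (spoke zero) zero (suc z))

  coreCentres-dominating : ¬ Fin p → Dominating G coreCentres
  coreCentres-dominating no-pendants u with pendantCentre-or-dominated u
  ... | inj₁ (t , _) = ⊥-elim (no-pendants t)
  ... | inj₂ u-dominated = u-dominated

  centres-dominating : Dominating G (coreCentres ∪ pendantCentres)
  centres-dominating u with pendantCentre-or-dominated u
  ... | inj₁ (t , refl) =
    pendantCentre t , x∈p∪q⁺ {p = coreCentres} {q = pendantCentres} (inj₂ (∈-image⁺ pendantCentre t)) , inj₁ refl
  ... | inj₂ (v , v∈ , u∈N[v]) =
    v , x∈p∪q⁺ {p = coreCentres} {q = pendantCentres} (inj₁ v∈) , u∈N[v]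

  coreCentres-isolating : Isolating G (K (suc p) r) coreCentres
  coreCentres-isolating f (f-injective , _) with all-or-any (pendantCentre-or-dominated ∘ f)
  ... | inj₂ some-dominated = some-dominated
  ... | inj₁ all-pendant with pigeonhole (n<1+n p) (proj₁ ∘ all-pendant)
  ... | i , j , i<j , same-pendant = ⊥-elim (<⇒≢ i<j (f-injective (begin
    f i                                    ≡⟨ proj₂ (all-pendant i) ⟩
    pendantCentre (proj₁ (all-pendant i))  ≡⟨ cong pendantCentre same-pendant ⟩
    pendantCentre (proj₁ (all-pendant j))  ≡⟨ sym (proj₂ (all-pendant j)) ⟩
    f j                                    ∎)))
    where open ≡-Reasoning

  hub : Label
  hub = spoke zero

  hub⇝ : ∀ x → EdgeChain G ⌜ x ⌝ ⟦ hub ⟧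
  hub⇝ ⟨ core j , a ⟩ =
    chain-step hub (spoke j) (suc zero) (suc zero) refl
      (chain-step (spoke j) (block (core j)) zero zero refl (chain-end (block (core j)) a))
  hub⇝ ⟨ pendant t , a ⟩ =
    chain-step hub (link t) zero zero refl
      (chain-step (link t) (block (pendant t)) (suc zero) (suc zero) refl (chain-end (block (pendant t)) a))
  hub⇝ (extra z) = chain-end hub (suc z)

  ⇝hub : ∀ x → ∃[ ℓ ] (⌜ x ⌝ ∈ ⟦ ℓ ⟧ × ∀ {w} → EdgeChain G w ⟦ hub ⟧ → EdgeChain G w ⟦ ℓ ⟧)
  ⇝hub ⟨ core j , a ⟩ =
    block (core j) , ∈⟦⟧ (block (core j)) a ,
    chain-step (block (core j)) (spoke j) zero zero refl ∘ chain-step (spoke j) hub (suc zero) (suc zero) refl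
  ⇝hub ⟨ pendant t , a ⟩ =
    block (pendant t) , ∈⟦⟧ (block (pendant t)) a ,
    chain-step (block (pendant t)) (link t) (suc zero) (suc zero) refl ∘ chain-step (link t) hub zero zero refl
  ⇝hub (extra z) = hub , ∈⟦⟧ hub (suc z) , id

  connected : Connected G
  connected = connected-via hub hub⇝ ⇝hub

  ι≡1+q : ∀ {k} → k ≤ suc s → Isolating G (K k r) coreCentres → IsIota G (K k r) (suc q)
  ι≡1+q k≤ C-isolating = (coreCentres , C-isolating , ∣coreCentres∣) , λ _ → isolating⇒≥ k≤

  γ≡1+q+p : IsGamma G (suc q + p)
  γ≡1+q+p =
    (coreCentres ∪ pendantCentres , centres-dominating , ≤-antisym centres-small (dominating⇒≥ centres-dominating)) ,
    λ _ → dominating⇒≥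
    where
    centres-small : ∣ coreCentres ∪ pendantCentres ∣ ≤ suc q + p
    centres-small = subst₂ (λ c d → ∣ coreCentres ∪ pendantCentres ∣ ≤ c + d) ∣coreCentres∣ ∣pendantCentres∣
      (∣p∪q∣≤∣p∣+∣q∣ coreCentres pendantCentres)

theorem3p2 : (k r : ℕ) → 1 ≤ k → k < r →
    ((H : Hypergraph) → Uniform r H → (i g : ℕ) → IsIota H (K k r) i → IsGamma H g →
      (g + 1 ≤ i + k) × (i ≤ g))
    × ((q : ℕ) → 1 ≤ q → ∃[ H ] ∃[ I ]
        (Connected H × Uniform r H × Connected I × Uniform r I
        × IsIota H (K k r) q × IsGamma H q
        × IsIota I (K k r) q × IsGamma I (q + k ∸ 1)))
theorem3p2 zero _ () _
theorem3p2 (suc _) zero _ ()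
theorem3p2 (suc _) (suc zero) _ (s≤s ())
theorem3p2 (suc k) (suc (suc s)) _ k<r@(s≤s (s≤s k≤s)) = (λ H _ _ _ → ι-γ-bounds k<r H) , λ where
  zero ()
  (suc q) _ →
    let module H = Construction q 0 s
        module I = Construction q k s
    in H.G , I.G , H.connected , H.uniform , I.connected , I.uniform ,
       H.ι≡1+q (s≤s k≤s) (dominating⇒isolating (K (suc k) _) zero (H.coreCentres-dominating λ ())) ,
       subst (IsGamma H.G) (+-identityʳ (suc q)) H.γ≡1+q+p ,
       I.ι≡1+q (s≤s k≤s) I.coreCentres-isolating ,
       subst (IsGamma I.G) (sym (+-suc q k)) I.γ≡1+q+p
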